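{- Let $n,k$ be positive integers, let $H$ be a $k$-graph on $[n]$, and let $s=\nu^*(H)=\tau^*(H)$. Suppose $\omega:[n]\to[0,1]$ is a minimum fractional vertex cover of $H$, and let $R=\{i\in[n]:\omega(i)>0\}$. Then $|R|\le ks$.
   Context: A fractional matching of a $k$-graph $H=(V,E)$ is $\phi:E\to[0,1]$ with $\sum_{e\ni v}\phi(e)\le1$ for all $v\in V$; $\nu^*(H)$ is the maximum of $\sum_e\phi(e)$ over fractional matchings. A fractional vertex cover is $\omega:V\to[0,1]$ with $\sum_{v\in e}\omega(v)\ge1$ for every $e\in E$; $\tau^*(H)$ is the minimum of $\sum_v\omega(v)$ over fractional vertex covers, and a minimum fractional vertex cover is one attaining it. By LP duality $\nu^*(H)=\tau^*(H)$.
   Formalization: The minimum fractional vertex cover ω takes rational values in [0,1] rather than real ones, and its minimality is compared with rational fractional vertex covers. -}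

module Defs where

open import Data.Nat using (ℕ; zero; suc)
open import Data.Fin using (Fin) renaming (zero to fz; suc to fs)
open import Data.Fin.Subset using (Subset; ∣_∣; _∈_; inside; outside)
open import Data.Vec using (lookup; tabulate)
open import Data.Bool using (if_then_else_)
open import Relation.Nullary using (does)
open import Data.List using (List)
open import Data.List.Relation.Unary.All using (All)
open import Data.List.Relation.Unary.Unique.Propositional using (Unique)
open import Data.Rational using (ℚ; 0ℚ; 1ℚ; _+_; _≤_; _<_; _<?_)
open import Data.Product using (_×_)
open import Relation.Binary.PropositionalEquality using (_≡_)

sumFin : {n : ℕ} → (Fin n → ℚ) → ℚ
sumFin {zero} f = 0ℚ
sumFin {suc n} f = f fz + sumFin (λ i → f (fs i))

restrict : {n : ℕ} → Subset n → (Fin n → ℚ) → Fin n → ℚ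
restrict S f i with lookup S i
... | inside = f i
... | outside = 0ℚ

sumOver : {n : ℕ} → Subset n → (Fin n → ℚ) → ℚ
sumOver S f = sumFin (restrict S f)

record KGraph (n k : ℕ) : Set where
  field
    edges   : List (Subset n)
    unique  : Unique edges
    uniform : All (λ e → ∣ e ∣ ≡ k) edges
open KGraph public

record IsFracCover {n k : ℕ} (H : KGraph n k) (ω : Fin n → ℚ) : Set where
  field
    nonneg : (v : Fin n) → 0ℚ ≤ ω v
    le-one : (v : Fin n) → ω v ≤ 1ℚ
    covers : All (λ e → 1ℚ ≤ sumOver e ω) (edges H)
open IsFracCover public

weight : {n : ℕ} → (Fin n → ℚ) → ℚ
weight ω = sumFin ω

record IsMinFracCover {n k : ℕ} (H : KGraph n k) (ω : Fin n → ℚ) : Set where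
  field
    isCover : IsFracCover H ω
    minimal : (ω' : Fin n → ℚ) → IsFracCover H ω' → weight ω ≤ weight ω'
open IsMinFracCover public

support : {n : ℕ} → (Fin n → ℚ) → Subset n
support ω = tabulate (λ i → if does (0ℚ <? ω i) then inside else outside)

{-# OPTIONS --safe #-}
module Submission where

-- Let ε > 0 be the least nonzero value of ω, R its support, and perturb ω
-- to ω + ε (k ω − 1_R).  The perturbation is nonnegative since ε ≤ ω on R,
-- and on an edge e of weight S ≥ 1 it adds ε (k S − |e ∩ R|) ≥ 0, because
-- |e ∩ R| ≤ k ≤ k S; so, truncated at 1, it is again a fractional cover.
-- Minimality of ω gives W ≤ W + ε (k W − |R|) for the total weight W,
-- that is |R| ≤ k W.

open import Defs
open import Data.Nat using (ℕ; NonZero; zero; suc)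
open import Data.Integer using (+_)
open import Data.Fin using (Fin) renaming (zero to fz; suc to fs)
open import Data.Fin.Subset using (∣_∣; Subset; inside; outside)
open import Data.Vec using ([]; _∷_; lookup)
open import Data.Vec.Properties using (lookup∘tabulate)
open import Data.Bool using (if_then_else_)
open import Data.Rational
  using (ℚ; _≤_; _*_; _/_; 0ℚ; 1ℚ; _+_; _-_; -_; _<_; _⊓_; _<?_; positive; nonNegative; toℚᵘ)
open import Data.Rational.Properties
  using (≤-refl; ≤-trans; ≤-reflexive; <⇒≤; ≤-total; module ≤-Reasoning;
         +-mono-≤; +-monoˡ-≤; +-monoʳ-≤; +-identityʳ; +-identityˡ; +-inverseʳ;
         *-identityʳ; *-zeroʳ; *-monoˡ-≤-nonNeg; *-cancelˡ-≤-pos;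
         nonNegative⁻¹; positive⁻¹; nonNeg*nonNeg⇒nonNeg; normalize-nonNeg;
         p⊓q≤p; p⊓q≤q; ⊓-glb; ⊓-sel; p≤q⇒p⊓q≡p; p≥q⇒p⊓q≡q;
         toℚᵘ-injective; toℚᵘ-fromℚᵘ; toℚᵘ-homo-+)
import Data.Rational.Unnormalised as ℚᵘ
import Data.Rational.Unnormalised.Properties as ℚᵘ
open import Data.Rational.Solver using (module +-*-Solver)
import Data.Integer as ℤ
import Data.Integer.Properties as ℤ
open import Data.List.Relation.Unary.All as All using (All)
open import Data.Product using (∃-syntax; _×_; _,_)
open import Data.Sum using (inj₁; inj₂)
open import Function using (_∘_)
open import Relation.Nullary using (¬_; yes; no; contradiction)
open import Relation.Nullary.Decidable using (dec-true; dec-false)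
open import Relation.Binary.PropositionalEquality using (_≡_; refl; sym; trans; cong; cong₂; subst)
open +-*-Solver using (solve; _:=_; _:+_; _:*_; _:-_; con)

private
  variable
    n k : ℕ
    p q r : ℚ

0<1 : 0ℚ < 1ℚ
0<1 = positive⁻¹ 1ℚ

*-nonNeg : 0ℚ ≤ p → 0ℚ ≤ q → 0ℚ ≤ p * q
*-nonNeg {p} {q} 0≤p 0≤q =
  nonNegative⁻¹ (p * q) {{nonNeg*nonNeg⇒nonNeg p {{nonNegative 0≤p}} q {{nonNegative 0≤q}}}}

p≤q⇒0≤q-p : p ≤ q → 0ℚ ≤ q - p
p≤q⇒0≤q-p {p = p} p≤q = ≤-trans (≤-reflexive (sym (+-inverseʳ p))) (+-monoˡ-≤ (- p) p≤q)

0≤q-p⇒p≤q : 0ℚ ≤ q - p → p ≤ q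
0≤q-p⇒p≤q {q = q} {p = p} 0≤q-p = begin
  p            ≡⟨ sym (+-identityˡ p) ⟩
  0ℚ + p       ≤⟨ +-monoˡ-≤ p 0≤q-p ⟩
  (q - p) + p  ≡⟨ solve 2 (λ p q → (q :- p) :+ p := q) refl p q ⟩
  q            ∎
  where open ≤-Reasoning

0≤q⇒p≤p+q : 0ℚ ≤ q → p ≤ p + q
0≤q⇒p≤p+q {q = q} {p = p} 0≤q = ≤-trans (≤-reflexive (sym (+-identityʳ p))) (+-monoʳ-≤ p 0≤q)

p≤p+q⇒0≤q : p ≤ p + q → 0ℚ ≤ q
p≤p+q⇒0≤q {p} {q} p≤p+q =
  subst (0ℚ ≤_) (solve 2 (λ p q → (p :+ q) :- p := q) refl p q) (p≤q⇒0≤q-p p≤p+q)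

p⊓[q+r]≤p⊓q+p⊓r : 0ℚ ≤ p → 0ℚ ≤ q → 0ℚ ≤ r → p ⊓ (q + r) ≤ p ⊓ q + p ⊓ r
p⊓[q+r]≤p⊓q+p⊓r {p} {q} {r} 0≤p 0≤q 0≤r with ≤-total p q | ≤-total p r
... | inj₁ p≤q | _ = begin
  p ⊓ (q + r)    ≤⟨ p⊓q≤p p (q + r) ⟩
  p              ≡⟨ sym (+-identityʳ p) ⟩
  p + 0ℚ         ≤⟨ +-mono-≤ (≤-reflexive (sym (p≤q⇒p⊓q≡p p≤q))) (⊓-glb 0≤p 0≤r) ⟩
  p ⊓ q + p ⊓ r  ∎
  where open ≤-Reasoning
... | inj₂ _ | inj₁ p≤r = begin
  p ⊓ (q + r)    ≤⟨ p⊓q≤p p (q + r) ⟩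
  p              ≡⟨ sym (+-identityˡ p) ⟩
  0ℚ + p         ≤⟨ +-mono-≤ (⊓-glb 0≤p 0≤q) (≤-reflexive (sym (p≤q⇒p⊓q≡p p≤r))) ⟩
  p ⊓ q + p ⊓ r  ∎
  where open ≤-Reasoning
... | inj₂ q≤p | inj₂ r≤p = begin
  p ⊓ (q + r)    ≤⟨ p⊓q≤q p (q + r) ⟩
  q + r          ≡⟨ sym (cong₂ _+_ (p≥q⇒p⊓q≡q q≤p) (p≥q⇒p⊓q≡q r≤p)) ⟩
  p ⊓ q + p ⊓ r  ∎
  where open ≤-Reasoning

-- _/_ normalises by a gcd that does not reduce for a variable m, so compare in ℚᵘ.
+[1+m]/1≡1+m/1 : ∀ m → (+ suc m) / 1 ≡ 1ℚ + (+ m) / 1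
+[1+m]/1≡1+m/1 m = toℚᵘ-injective (begin-equality
  toℚᵘ ((+ suc m) / 1)               ≃⟨ toℚᵘ-fromℚᵘ (ℚᵘ.mkℚᵘ (+ suc m) 0) ⟩
  ℚᵘ.mkℚᵘ (+ suc m) 0                ≃⟨ ℚᵘ.*≡* numerators ⟩
  ℚᵘ.1ℚᵘ ℚᵘ.+ ℚᵘ.mkℚᵘ (+ m) 0        ≃⟨ ℚᵘ.+-cong (toℚᵘ-fromℚᵘ ℚᵘ.1ℚᵘ) (toℚᵘ-fromℚᵘ (ℚᵘ.mkℚᵘ (+ m) 0)) ⟨
  toℚᵘ 1ℚ ℚᵘ.+ toℚᵘ ((+ m) / 1)      ≃⟨ toℚᵘ-homo-+ 1ℚ ((+ m) / 1) ⟨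
  toℚᵘ (1ℚ + (+ m) / 1)              ∎)
  where
  open ℚᵘ.≤-Reasoning
  numerators : + suc m ℤ.* + 1 ≡ (+ 1 ℤ.* + 1 ℤ.+ + m ℤ.* + 1) ℤ.* + 1
  numerators = trans (ℤ.*-identityʳ (+ suc m))
    (sym (trans (ℤ.*-identityʳ _) (cong (ℤ._+_ (+ 1)) (ℤ.*-identityʳ (+ m)))))

sumFin-cong : {f g : Fin n → ℚ} → (∀ i → f i ≡ g i) → sumFin f ≡ sumFin g
sumFin-cong {zero}  f≡g = refl
sumFin-cong {suc n} f≡g = cong₂ _+_ (f≡g fz) (sumFin-cong (f≡g ∘ fs))

sumFin-mono : {f g : Fin n → ℚ} → (∀ i → f i ≤ g i) → sumFin f ≤ sumFin g
sumFin-mono {zero}  f≤g = ≤-refl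
sumFin-mono {suc n} f≤g = +-mono-≤ (f≤g fz) (sumFin-mono (f≤g ∘ fs))

sumFin-nonNeg : {f : Fin n → ℚ} → (∀ i → 0ℚ ≤ f i) → 0ℚ ≤ sumFin f
sumFin-nonNeg {zero}  0≤f = ≤-refl
sumFin-nonNeg {suc n} 0≤f = +-mono-≤ (0≤f fz) (sumFin-nonNeg (0≤f ∘ fs))

sumFin-additive : (L : ℚ → ℚ → ℚ) → L 0ℚ 0ℚ ≡ 0ℚ →
                  (∀ x y x′ y′ → L (x + x′) (y + y′) ≡ L x y + L x′ y′) →
                  (f g : Fin n → ℚ) → sumFin (λ i → L (f i) (g i)) ≡ L (sumFin f) (sumFin g)
sumFin-additive {zero}  L L-zero L-+ f g = sym L-zero
sumFin-additive {suc n} L L-zero L-+ f g =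
  trans (cong (_+_ (L (f fz) (g fz))) (sumFin-additive L L-zero L-+ (f ∘ fs) (g ∘ fs)))
        (sym (L-+ _ _ _ _))

sumFin-⊓ : {f : Fin n → ℚ} → 0ℚ ≤ p → (∀ i → 0ℚ ≤ f i) → p ⊓ sumFin f ≤ sumFin (λ i → p ⊓ f i)
sumFin-⊓ {zero}  {p = p} 0≤p 0≤f = p⊓q≤q p 0ℚ
sumFin-⊓ {suc n} {p = p} {f} 0≤p 0≤f =
  ≤-trans (p⊓[q+r]≤p⊓q+p⊓r 0≤p (0≤f fz) (sumFin-nonNeg (0≤f ∘ fs)))
          (+-monoʳ-≤ (p ⊓ f fz) (sumFin-⊓ 0≤p (0≤f ∘ fs)))

restrict-suc : ∀ s (S : Subset n) (f : Fin (suc n) → ℚ) i →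
               restrict (s ∷ S) f (fs i) ≡ restrict S (f ∘ fs) i
restrict-suc s S f i with lookup S i
... | inside  = refl
... | outside = refl

restrict-inside : (S : Subset n) (f : Fin n → ℚ) {i : Fin n} →
                  lookup S i ≡ inside → restrict S f i ≡ f i
restrict-inside S f {i} i∈S with lookup S i
restrict-inside S f refl | inside = refl

restrict-outside : (S : Subset n) (f : Fin n → ℚ) {i : Fin n} →
                   lookup S i ≡ outside → restrict S f i ≡ 0ℚ
restrict-outside S f {i} i∉S with lookup S i
restrict-outside S f refl | outside = refl

restrict-map : (G : ℚ → ℚ) → G 0ℚ ≡ 0ℚ → (S : Subset n) (f : Fin n → ℚ) →
               ∀ i → restrict S (G ∘ f) i ≡ G (restrict S f i)
restrict-map G G-zero S f i with lookup S i
... | inside  = refl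
... | outside = sym G-zero

restrict-zipWith : (F : ℚ → ℚ → ℚ) → F 0ℚ 0ℚ ≡ 0ℚ → (S : Subset n) (f g : Fin n → ℚ) →
                   ∀ i → restrict S (λ j → F (f j) (g j)) i ≡ F (restrict S f i) (restrict S g i)
restrict-zipWith F F-zero S f g i with lookup S i
... | inside  = refl
... | outside = sym F-zero

restrict-mono : (S : Subset n) {f g : Fin n → ℚ} → (∀ i → f i ≤ g i) →
                ∀ i → restrict S f i ≤ restrict S g i
restrict-mono S f≤g i with lookup S i
... | inside  = f≤g i
... | outside = ≤-refl

restrict-nonNeg : (S : Subset n) {f : Fin n → ℚ} → (∀ i → 0ℚ ≤ f i) → ∀ i → 0ℚ ≤ restrict S f i
restrict-nonNeg S 0≤f i with lookup S i
... | inside  = 0≤f i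
... | outside = ≤-refl

sumOver-additive : (L : ℚ → ℚ → ℚ) → L 0ℚ 0ℚ ≡ 0ℚ →
                   (∀ x y x′ y′ → L (x + x′) (y + y′) ≡ L x y + L x′ y′) →
                   (S : Subset n) (f g : Fin n → ℚ) →
                   sumOver S (λ i → L (f i) (g i)) ≡ L (sumOver S f) (sumOver S g)
sumOver-additive L L-zero L-+ S f g =
  trans (sumFin-cong (restrict-zipWith L L-zero S f g))
        (sumFin-additive L L-zero L-+ (restrict S f) (restrict S g))

indicator : Subset n → Fin n → ℚ
indicator S = restrict S (λ _ → 1ℚ)

indicator≤1 : (S : Subset n) → ∀ i → indicator S i ≤ 1ℚ
indicator≤1 S i with lookup S i
... | inside  = ≤-refl
... | outside = <⇒≤ 0<1

sumFin-indicator : (S : Subset n) → sumFin (indicator S) ≡ (+ ∣ S ∣) / 1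
sumFin-indicator [] = refl
sumFin-indicator (inside ∷ S) =
  trans (cong (_+_ 1ℚ) (trans (sumFin-cong (restrict-suc inside S _)) (sumFin-indicator S)))
        (sym (+[1+m]/1≡1+m/1 ∣ S ∣))
sumFin-indicator (outside ∷ S) =
  trans (cong (_+_ 0ℚ) (trans (sumFin-cong (restrict-suc outside S _)) (sumFin-indicator S)))
        (+-identityˡ _)

support-inside : (ω : Fin n → ℚ) {v : Fin n} → 0ℚ < ω v → lookup (support ω) v ≡ inside
support-inside ω {v} 0<ωv = trans (lookup∘tabulate _ v)
  (cong (λ b → if b then inside else outside) (dec-true (0ℚ <? ω v) 0<ωv))

support-outside : (ω : Fin n → ℚ) {v : Fin n} → ¬ (0ℚ < ω v) → lookup (support ω) v ≡ outside
support-outside ω {v} 0≮ωv = trans (lookup∘tabulate _ v)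
  (cong (λ b → if b then inside else outside) (dec-false (0ℚ <? ω v) 0≮ωv))

*-indicator-support≤ : {ε : ℚ} {ω : Fin n → ℚ} → (∀ v → 0ℚ ≤ ω v) → (∀ v → 0ℚ < ω v → ε ≤ ω v) →
                       ∀ v → ε * indicator (support ω) v ≤ ω v
*-indicator-support≤ {ε = ε} {ω} 0≤ω ε≤ω v with 0ℚ <? ω v
... | yes 0<ωv = begin
  ε * indicator (support ω) v  ≡⟨ cong (ε *_) (restrict-inside (support ω) _ (support-inside ω 0<ωv)) ⟩
  ε * 1ℚ                       ≡⟨ *-identityʳ ε ⟩
  ε                            ≤⟨ ε≤ω v 0<ωv ⟩
  ω v                          ∎
  where open ≤-Reasoning
... | no 0≮ωv = begin
  ε * indicator (support ω) v  ≡⟨ cong (ε *_) (restrict-outside (support ω) _ (support-outside ω 0≮ωv)) ⟩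
  ε * 0ℚ                       ≡⟨ *-zeroʳ ε ⟩
  0ℚ                           ≤⟨ 0≤ω v ⟩
  ω v                          ∎
  where open ≤-Reasoning

positive-lowerBound : (f : Fin n → ℚ) → ∃[ ε ] 0ℚ < ε × (∀ i → 0ℚ < f i → ε ≤ f i)
positive-lowerBound {zero}  f = 1ℚ , 0<1 , λ ()
positive-lowerBound {suc n} f with positive-lowerBound (f ∘ fs) | 0ℚ <? f fz
... | ε , 0<ε , ε≤f | no 0≮f₀ = ε , 0<ε , bound
  where
  bound : ∀ i → 0ℚ < f i → ε ≤ f i
  bound fz     0<f₀ = contradiction 0<f₀ 0≮f₀
  bound (fs i) 0<fᵢ = ε≤f i 0<fᵢ
... | ε , 0<ε , ε≤f | yes 0<f₀ = ε ⊓ f fz , 0<ε⊓f₀ , bound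
  where
  0<ε⊓f₀ : 0ℚ < ε ⊓ f fz
  0<ε⊓f₀ with ⊓-sel ε (f fz)
  ... | inj₁ ε⊓f₀≡ε  = subst (0ℚ <_) (sym ε⊓f₀≡ε) 0<ε
  ... | inj₂ ε⊓f₀≡f₀ = subst (0ℚ <_) (sym ε⊓f₀≡f₀) 0<f₀
  bound : ∀ i → 0ℚ < f i → ε ⊓ f fz ≤ f i
  bound fz     _    = p⊓q≤q ε (f fz)
  bound (fs i) 0<fᵢ = ≤-trans (p⊓q≤p ε (f fz)) (ε≤f i 0<fᵢ)

Covers : KGraph n k → (Fin n → ℚ) → Set
Covers H a = All (λ e → 1ℚ ≤ sumOver e a) (edges H)

truncate-isFracCover : (H : KGraph n k) {a : Fin n → ℚ} → (∀ v → 0ℚ ≤ a v) → Covers H a →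
                       IsFracCover H (λ v → 1ℚ ⊓ a v)
truncate-isFracCover H {a} 0≤a a-covers = record
  { nonneg = λ v → ⊓-glb (<⇒≤ 0<1) (0≤a v)
  ; le-one = λ v → p⊓q≤p 1ℚ (a v)
  ; covers = All.map (λ {e} → truncated-covers e) a-covers
  }
  where
  truncated-covers : ∀ e → 1ℚ ≤ sumOver e a → 1ℚ ≤ sumOver e (λ v → 1ℚ ⊓ a v)
  truncated-covers e 1≤a[e] = begin
    1ℚ                                 ≡⟨ p≤q⇒p⊓q≡p 1≤a[e] ⟨
    1ℚ ⊓ sumOver e a                   ≤⟨ sumFin-⊓ (<⇒≤ 0<1) (restrict-nonNeg e 0≤a) ⟩
    sumFin (λ i → 1ℚ ⊓ restrict e a i) ≡⟨ sumFin-cong (restrict-map (1ℚ ⊓_) refl e a) ⟨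
    sumOver e (λ v → 1ℚ ⊓ a v)         ∎
    where open ≤-Reasoning

weight-minimal≤ : {H : KGraph n k} {ω a : Fin n → ℚ} → IsMinFracCover H ω →
                  (∀ v → 0ℚ ≤ a v) → Covers H a → weight ω ≤ weight a
weight-minimal≤ {H = H} {a = a} ω-min 0≤a a-covers =
  ≤-trans (minimal ω-min _ (truncate-isFracCover H 0≤a a-covers)) (sumFin-mono (λ v → p⊓q≤q 1ℚ (a v)))

perturb : (ε κ x y : ℚ) → ℚ
perturb ε κ x y = x + ε * (κ * x - y)

perturb-zero : ∀ ε κ → perturb ε κ 0ℚ 0ℚ ≡ 0ℚ
perturb-zero ε κ = solve 2 (λ ε κ → con 0ℚ :+ ε :* (κ :* con 0ℚ :- con 0ℚ) := con 0ℚ) refl ε κ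

perturb-+ : ∀ ε κ x y x′ y′ → perturb ε κ (x + x′) (y + y′) ≡ perturb ε κ x y + perturb ε κ x′ y′
perturb-+ ε κ = solve 6 (λ ε κ x y x′ y′ →
  (x :+ x′) :+ ε :* (κ :* (x :+ x′) :- (y :+ y′)) :=
  (x :+ ε :* (κ :* x :- y)) :+ (x′ :+ ε :* (κ :* x′ :- y′))) refl ε κ

perturb-nonNeg : ∀ {ε κ x y} → 0ℚ ≤ ε → 0ℚ ≤ κ → 0ℚ ≤ x → ε * y ≤ x → 0ℚ ≤ perturb ε κ x y
perturb-nonNeg {ε} {κ} {x} {y} 0≤ε 0≤κ 0≤x εy≤x = begin
  0ℚ                        ≤⟨ +-mono-≤ (p≤q⇒0≤q-p εy≤x) (*-nonNeg 0≤ε (*-nonNeg 0≤κ 0≤x)) ⟩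
  (x - ε * y) + ε * (κ * x) ≡⟨ solve 4 (λ ε κ x y → (x :- ε :* y) :+ ε :* (κ :* x)
                                                   := x :+ ε :* (κ :* x :- y)) refl ε κ x y ⟩
  perturb ε κ x y           ∎
  where open ≤-Reasoning

≤-perturb : ∀ {ε κ x y} → 0ℚ ≤ ε → y ≤ κ * x → x ≤ perturb ε κ x y
≤-perturb 0≤ε y≤κx = 0≤q⇒p≤p+q (*-nonNeg 0≤ε (p≤q⇒0≤q-p y≤κx))

≤-perturb⁻¹ : ∀ {ε κ x y} → 0ℚ < ε → x ≤ perturb ε κ x y → y ≤ κ * x
≤-perturb⁻¹ {ε = ε} 0<ε x≤perturb = 0≤q-p⇒p≤q (*-cancelˡ-≤-pos ε {{positive 0<ε}}
  (≤-trans (≤-reflexive (*-zeroʳ ε)) (p≤p+q⇒0≤q x≤perturb)))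

module Perturbation (H : KGraph n k) {ω : Fin n → ℚ} (ω-cover : IsFracCover H ω)
                    {ε : ℚ} (0≤ε : 0ℚ ≤ ε) (ε≤ω : ∀ v → 0ℚ < ω v → ε ≤ ω v) where

  κ : ℚ
  κ = (+ k) / 1

  0≤κ : 0ℚ ≤ κ
  0≤κ = nonNegative⁻¹ κ {{normalize-nonNeg k 1}}

  perturbed : Fin n → ℚ
  perturbed v = perturb ε κ (ω v) (indicator (support ω) v)

  perturbed-nonNeg : ∀ v → 0ℚ ≤ perturbed v
  perturbed-nonNeg v = perturb-nonNeg 0≤ε 0≤κ (nonneg ω-cover v)
    (*-indicator-support≤ (nonneg ω-cover) ε≤ω v)

  perturbed-covers : Covers H perturbed
  perturbed-covers = All.zipWith (λ {e} (∣e∣≡k , 1≤ω[e]) → edge-covered e ∣e∣≡k 1≤ω[e])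
                                 (uniform H , covers ω-cover)
    where
    edge-covered : ∀ e → ∣ e ∣ ≡ k → 1ℚ ≤ sumOver e ω → 1ℚ ≤ sumOver e perturbed
    edge-covered e ∣e∣≡k 1≤ω[e] = begin
      1ℚ                  ≤⟨ 1≤ω[e] ⟩
      S                   ≤⟨ ≤-perturb {κ = κ} 0≤ε I≤κS ⟩
      perturb ε κ S I     ≡⟨ sumOver-additive (perturb ε κ) (perturb-zero ε κ) (perturb-+ ε κ)
                                              e ω (indicator (support ω)) ⟨
      sumOver e perturbed ∎
      where
      open ≤-Reasoning
      S I : ℚ
      S = sumOver e ω
      I = sumOver e (indicator (support ω))
      I≤κS : I ≤ κ * S
      I≤κS = begin
        I                    ≤⟨ sumFin-mono (restrict-mono e (indicator≤1 (support ω))) ⟩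
        sumFin (indicator e) ≡⟨ sumFin-indicator e ⟩
        (+ ∣ e ∣) / 1        ≡⟨ cong (λ m → (+ m) / 1) ∣e∣≡k ⟩
        κ                    ≡⟨ *-identityʳ κ ⟨
        κ * 1ℚ               ≤⟨ *-monoˡ-≤-nonNeg κ {{nonNegative 0≤κ}} 1≤ω[e] ⟩
        κ * S                ∎

  weight-perturbed : weight perturbed ≡ perturb ε κ (weight ω) ((+ ∣ support ω ∣) / 1)
  weight-perturbed =
    trans (sumFin-additive (perturb ε κ) (perturb-zero ε κ) (perturb-+ ε κ) ω (indicator (support ω)))
          (cong (perturb ε κ (weight ω)) (sumFin-indicator (support ω)))

proposition2p1 : (n k : ℕ) → .{{_ : NonZero n}} → .{{_ : NonZero k}} → (H : KGraph n k) → (ω : Fin n → ℚ) → IsMinFracCover H ω → (+ ∣ support ω ∣) / 1 ≤ ((+ k) / 1) * weight ω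
proposition2p1 n k H ω ω-min with positive-lowerBound ω
... | ε , 0<ε , ε≤ω = ≤-perturb⁻¹ {κ = κ} 0<ε (begin
  weight ω          ≤⟨ weight-minimal≤ ω-min perturbed-nonNeg perturbed-covers ⟩
  weight perturbed  ≡⟨ weight-perturbed ⟩
  perturb ε κ (weight ω) ((+ ∣ support ω ∣) / 1) ∎)
  where
  open ≤-Reasoning
  open Perturbation H (isCover ω-min) (<⇒≤ 0<ε) ε≤ω
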